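{- Let $n>4$. Every tiling of the honeycomb strip $H_n$ by monomers and dimers can be broken (i.e. cut only along boundaries between tiles) into consecutive tiled sub-strips of consecutive positions, each of which is unbreakable and is of one of the following four types: (M) a length-one strip tiled by a single monomer; (D) a length-two strip $\{i,i+1\}$ tiled by a single (slanted) dimer; (T) a length-three strip $\{i,i+1,i+2\}$ tiled by the horizontal dimer $\{i,i+2\}$ and the monomer $\{i+1\}$; (V) a length-four strip $\{i,i+1,i+2,i+3\}$ tiled by the two horizontal dimers $\{i,i+2\}$ and $\{i+1,i+3\}$.
   Context: The honeycomb strip $H_n$ consists of $n$ regular hexagons arranged in two rows, numbered $1,\dots,n$ from the bottom left so that odd-numbered hexagons form the bottom row and even-numbered ones the top row; hexagon $i$ shares an edge with hexagons $i\pm1$ and $i\pm2$ (when they exist), and with no others. A monomer is a single hexagon; a dimer is a pair of edge-adjacent hexagons, i.e. either $\{i,i+1\}$ (slanted) or $\{i,i+2\}$ (horizontal). A tiling of $H_n$ is a partition of its hexagons into monomers and dimers. A tiling is breakable at position $k$ ($1\le k<n$) if every tile lies entirely within $\{1,\dots,k\}$ or entirely within $\{k+1,\dots,n\}$, so that it splits into a tiling of the first $k$ hexagons and a tiling of the remaining $n-k$; a tiled strip is unbreakable if it is breakable at no position. -}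

module Defs where

open import Data.Nat using (ℕ; zero; suc; _+_; _≤_; _<_)
open import Data.List using (List; []; _∷_; _++_; map)
open import Data.List.Membership.Propositional using (_∈_)
open import Data.List.Relation.Unary.All using (All)
open import Data.Product using (_×_; _,_; ∃-syntax; Σ-syntax)
open import Data.Sum using (_⊎_)
open import Relation.Binary.PropositionalEquality using (_≡_)
open import Relation.Nullary using (¬_)

-- Hexagons of H_n are the positions 1, …, n.
-- A tile: a monomer {i}, a slanted dimer {i, i+1}, or a horizontal dimer {i, i+2}.
data Tile : Set where
  mono  : ℕ → Tile
  slant : ℕ → Tile
  horiz : ℕ → Tile

cells : Tile → List ℕ
cells (mono i)  = i ∷ []
cells (slant i) = i ∷ suc i ∷ []
cells (horiz i) = i ∷ suc (suc i) ∷ []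

-- A (finite set of) tiles, given as a list, is a tiling of H_n: every tile
-- lies in {1..n}, every hexagon is covered, and no two distinct tiles overlap
-- (the list is read as a set; repeated entries denote the same tile).
IsTiling : ℕ → List Tile → Set
IsTiling n ts =
  (∀ {t k} → t ∈ ts → k ∈ cells t → 1 ≤ k × k ≤ n)
  × (∀ k → 1 ≤ k → k ≤ n → ∃[ t ] (t ∈ ts × k ∈ cells t))
  × (∀ {t t′ k} → t ∈ ts → t′ ∈ ts → k ∈ cells t → k ∈ cells t′ → t ≡ t′)

BreakableAt : ℕ → List Tile → Set
BreakableAt k ts = ∀ {t} → t ∈ ts → All (_≤ k) (cells t) ⊎ All (k <_) (cells t)

Unbreakable : ℕ → ℕ → List Tile → Set
Unbreakable a ℓ ts = ∀ k → a ≤ k → suc k < a + ℓ → ¬ BreakableAt k ts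

data Block : Set where
  M D T V : Block

len : Block → ℕ
len M = 1
len D = 2
len T = 3
len V = 4

blockTiles : Block → ℕ → List Tile
blockTiles M i = mono i ∷ []
blockTiles D i = slant i ∷ []
blockTiles T i = horiz i ∷ mono (suc i) ∷ []
blockTiles V i = horiz i ∷ horiz (suc i) ∷ []

placed : ℕ → List Block → List (ℕ × Block)
placed s []       = []
placed s (b ∷ bs) = (s , b) ∷ placed (s + len b) bs

placedTiles : List (ℕ × Block) → List Tile
placedTiles []             = []
placedTiles ((s , b) ∷ ps) = blockTiles b s ++ placedTiles ps

PlacedUnbreakable : ℕ × Block → Set
PlacedUnbreakable (s , b) = Unbreakable s (len b) (blockTiles b s)

module Submission where

open import Defs
open import Data.Nat using (ℕ; suc; _+_; _∸_; _≤_; _<_; z≤n; z<s; s<s; s<s⁻¹; _≤?_; _<?_)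
open import Data.Nat.Properties
open import Data.Nat.Induction using (<-wellFounded)
open import Data.List using (List; []; _∷_; map)
open import Data.Nat.ListAction using (sum)
open import Data.List.Membership.Propositional using (_∈_)
open import Data.List.Membership.Propositional.Properties using (∈-++⁺ˡ; ∈-++⁺ʳ; ∈-++⁻)
open import Data.List.Relation.Binary.Subset.Propositional using (_⊆_)
open import Data.List.Relation.Unary.Any using (here; there)
open import Data.List.Relation.Unary.All as All using (All; []; _∷_)
open import Data.Product using (_×_; _,_; ∃-syntax; proj₁; proj₂)
open import Data.Sum using (inj₁; inj₂)
open import Data.Empty using (⊥-elim)
open import Function using (_∘_)
open import Induction.WellFounded using (Acc; acc)
open import Relation.Nullary using (¬_; yes; no)
open import Relation.Binary.PropositionalEquality

-- Read the tiling from left to right. If it is breakable at k, the tile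
-- covering k+1 cannot straddle k, so it starts at k+1: a monomer (M), a
-- slanted dimer (D), or the horizontal dimer {k+1, k+3}. In the last case
-- hexagon k+2 is covered by a monomer (T) or by the horizontal dimer
-- {k+2, k+4} (V), since a slanted dimer would overlap {k+1, k+3} and
-- {k, k+2} would straddle k. The tiling is then breakable again right after
-- the block, and every block is unbreakable because a dimer straddles each of
-- its interior cuts.

first : Tile → ℕ
first (mono i)  = i
first (slant i) = i
first (horiz i) = i

first∈cells : ∀ t → first t ∈ cells t
first∈cells (mono i)  = here refl
first∈cells (slant i) = here refl
first∈cells (horiz i) = here refl

first≤cell : ∀ {t c} → c ∈ cells t → first t ≤ c
first≤cell {mono i}  (here refl)         = ≤-refl
first≤cell {slant i} (here refl)         = ≤-refl
first≤cell {slant i} (there (here refl)) = n≤1+n i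
first≤cell {horiz i} (here refl)         = ≤-refl
first≤cell {horiz i} (there (here refl)) = m≤n+m i 2

straddle⇒¬breakable : ∀ {ts t a c k} → t ∈ ts → a ∈ cells t → c ∈ cells t →
                      a ≤ k → k < c → ¬ BreakableAt k ts
straddle⇒¬breakable t∈ a∈ c∈ a≤k k<c breakable with breakable t∈
... | inj₁ cells≤k = <⇒≱ k<c (All.lookup cells≤k c∈)
... | inj₂ k<cells = <⇒≱ (All.lookup k<cells a∈) a≤k

slant≢horiz : ∀ {i j} → slant i ≢ horiz j
slant≢horiz ()

0<len : ∀ b → 0 < len b
0<len M = z<s
0<len D = z<s
0<len T = z<s
0<len V = z<s

-- Cells of a block placed after k are written o + suc k with o < len b: with
-- the offset on the left this computes to the cell for each literal o.

block-cell-offset : ∀ b k {t c} → t ∈ blockTiles b (suc k) → c ∈ cells t →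
                    ∃[ o ] (o < len b × c ≡ o + suc k)
block-cell-offset M k (here refl)         (here refl)         = 0 , z<s , refl
block-cell-offset D k (here refl)         (here refl)         = 0 , z<s , refl
block-cell-offset D k (here refl)         (there (here refl)) = 1 , s<s z<s , refl
block-cell-offset T k (here refl)         (here refl)         = 0 , z<s , refl
block-cell-offset T k (here refl)         (there (here refl)) = 2 , s<s (s<s z<s) , refl
block-cell-offset T k (there (here refl)) (here refl)         = 1 , s<s z<s , refl
block-cell-offset V k (here refl)         (here refl)         = 0 , z<s , refl
block-cell-offset V k (here refl)         (there (here refl)) = 2 , s<s (s<s z<s) , refl
block-cell-offset V k (there (here refl)) (here refl)         = 1 , s<s z<s , refl
block-cell-offset V k (there (here refl)) (there (here refl)) = 3 , s<s (s<s (s<s z<s)) , refl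

block-covers-offset : ∀ b k {o} → o < len b →
                      ∃[ t ] (t ∈ blockTiles b (suc k) × o + suc k ∈ cells t)
block-covers-offset M k {0} _ = mono (suc k) , here refl , here refl
block-covers-offset D k {0} _ = slant (suc k) , here refl , here refl
block-covers-offset D k {1} _ = slant (suc k) , here refl , there (here refl)
block-covers-offset T k {0} _ = horiz (suc k) , here refl , here refl
block-covers-offset T k {1} _ = mono (suc (suc k)) , there (here refl) , here refl
block-covers-offset T k {2} _ = horiz (suc k) , here refl , there (here refl)
block-covers-offset V k {0} _ = horiz (suc k) , here refl , here refl
block-covers-offset V k {1} _ = horiz (suc (suc k)) , there (here refl) , here refl
block-covers-offset V k {2} _ = horiz (suc k) , here refl , there (here refl)
block-covers-offset V k {3} _ = horiz (suc (suc k)) , there (here refl) , there (here refl)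
block-covers-offset M k {suc _} (s<s ())
block-covers-offset D k {suc (suc _)} (s<s (s<s ()))
block-covers-offset T k {suc (suc (suc _))} (s<s (s<s (s<s ())))
block-covers-offset V k {suc (suc (suc (suc _)))} (s<s (s<s (s<s (s<s ()))))

block-cell-bounds : ∀ b k {t c} → t ∈ blockTiles b (suc k) → c ∈ cells t →
                    k < c × c ≤ k + len b
block-cell-bounds b k t∈ c∈ with block-cell-offset b k t∈ c∈
... | o , o<len , refl =
  m≤n+m (suc k) o , subst (_≤ k + len b) (+-comm (suc k) o) (+-monoʳ-< k o<len)

block-covers : ∀ b k {p} → k < p → p ≤ k + len b →
               ∃[ t ] (t ∈ blockTiles b (suc k) × p ∈ cells t)
block-covers b k {p} k<p p≤end with block-covers-offset b k o<len
  where
    o = p ∸ suc k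
    o<len : o < len b
    o<len = +-cancelˡ-< k o (len b)
              (subst (_≤ k + len b) (trans (sym (m∸n+n≡m k<p)) (+-comm o (suc k))) p≤end)
... | t , t∈ , o+k+1∈ = t , t∈ , subst (_∈ cells t) (m∸n+n≡m k<p) o+k+1∈

block-unbreakable : ∀ b k → PlacedUnbreakable (suc k , b)
block-unbreakable b k j k<j j<end =
  unbreakable b k<j (subst (j <_) (+-comm k (len b)) (s<s⁻¹ j<end))
  where
    unbreakable : ∀ b {j} → k < j → j < len b + k → ¬ BreakableAt j (blockTiles b (suc k))
    unbreakable M k<j j<end _ = <⇒≱ k<j (≤-pred j<end)
    unbreakable D k<j j<end   = straddle⇒¬breakable (here refl) (here refl) (there (here refl)) k<j j<end
    unbreakable T k<j j<end   = straddle⇒¬breakable (here refl) (here refl) (there (here refl)) k<j j<end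
    unbreakable V {j} k<j j<end with j <? 3 + k
    ... | yes j<3+k = straddle⇒¬breakable (here refl) (here refl) (there (here refl)) k<j j<3+k
    ... | no  j≮3+k = straddle⇒¬breakable (there (here refl)) (here refl) (there (here refl))
                        (≤-trans (n≤1+n _) (≮⇒≥ j≮3+k)) j<end

module Greedy (n : ℕ) (ts : List Tile)
  (inside   : ∀ {t k} → t ∈ ts → k ∈ cells t → 1 ≤ k × k ≤ n)
  (covered  : ∀ k → 1 ≤ k → k ≤ n → ∃[ t ] (t ∈ ts × k ∈ cells t))
  (disjoint : ∀ {t t′ k} → t ∈ ts → t′ ∈ ts → k ∈ cells t → k ∈ cells t′ → t ≡ t′) where

  block-after-horiz : ∀ k → BreakableAt k ts → horiz (suc k) ∈ ts →
                      ∀ u → u ∈ ts → suc (suc k) ∈ cells u → ∃[ b ] (blockTiles b (suc k) ⊆ ts)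
  block-after-horiz k _ h∈ (mono _) u∈ (here refl) =
    T , λ { (here refl) → h∈ ; (there (here refl)) → u∈ }
  block-after-horiz k _ h∈ (horiz _) u∈ (here refl) =
    V , λ { (here refl) → h∈ ; (there (here refl)) → u∈ }
  block-after-horiz k _ h∈ (slant _) u∈ (here refl) =
    ⊥-elim (slant≢horiz (disjoint u∈ h∈ (there (here refl)) (there (here refl))))
  block-after-horiz k _ h∈ (slant _) u∈ (there (here refl)) =
    ⊥-elim (slant≢horiz (disjoint u∈ h∈ (here refl) (here refl)))
  block-after-horiz k breakable h∈ (horiz _) u∈ (there (here refl)) =
    ⊥-elim (straddle⇒¬breakable u∈ (here refl) (there (here refl)) ≤-refl (m<n⇒m<1+n (n<1+n k)) breakable)

  block-starting-with : ∀ k → BreakableAt k ts →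
                        ∀ t → t ∈ ts → suc k ∈ cells t → ∃[ b ] (blockTiles b (suc k) ⊆ ts)
  block-starting-with k _ (mono _) t∈ (here refl) = M , λ { (here refl) → t∈ }
  block-starting-with k _ (slant _) t∈ (here refl) = D , λ { (here refl) → t∈ }
  block-starting-with k breakable (slant _) t∈ (there (here refl)) =
    ⊥-elim (straddle⇒¬breakable t∈ (here refl) (there (here refl)) ≤-refl ≤-refl breakable)
  block-starting-with k breakable (horiz _) t∈ (here refl)
    with covered (suc (suc k)) z<s (≤-trans (n≤1+n _) (proj₂ (inside t∈ (there (here refl)))))
  ... | u , u∈ , k+2∈u = block-after-horiz k breakable t∈ u u∈ k+2∈u
  block-starting-with .(suc j) breakable (horiz j) t∈ (there (here refl)) =
    ⊥-elim (straddle⇒¬breakable t∈ (here refl) (there (here refl)) (n≤1+n j) ≤-refl breakable)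

  next-block : ∀ k → BreakableAt k ts → k < n → ∃[ b ] (blockTiles b (suc k) ⊆ ts)
  next-block k breakable k<n with covered (suc k) z<s k<n
  ... | t , t∈ , k+1∈t = block-starting-with k breakable t t∈ k+1∈t

  block-fits : ∀ b k → blockTiles b (suc k) ⊆ ts → k + len b ≤ n
  block-fits b k block⊆ with block-covers b k (m<m+n k (0<len b)) ≤-refl
  ... | t , t∈ , end∈t = proj₂ (inside (block⊆ t∈) end∈t)

  tile-in-block : ∀ {b k t} → blockTiles b (suc k) ⊆ ts → t ∈ ts →
                  k < first t → first t ≤ k + len b → t ∈ blockTiles b (suc k)
  tile-in-block {b} {k} {t} block⊆ t∈ k<first first≤end with block-covers b k k<first first≤end
  ... | u , u∈ , first∈u =
    subst (_∈ blockTiles b (suc k)) (sym (disjoint t∈ (block⊆ u∈) (first∈cells t) first∈u)) u∈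

  breakable-after-block : ∀ {b k} → BreakableAt k ts → blockTiles b (suc k) ⊆ ts →
                          BreakableAt (k + len b) ts
  breakable-after-block {b} {k} breakable block⊆ {t} t∈ with breakable t∈
  ... | inj₁ cells≤k = inj₁ (All.map (λ c≤k → ≤-trans c≤k (m≤m+n k (len b))) cells≤k)
  ... | inj₂ k<cells with first t ≤? k + len b
  ...   | yes first≤end = inj₁ (All.tabulate (proj₂ ∘ block-cell-bounds b k t∈block))
    where
      t∈block : t ∈ blockTiles b (suc k)
      t∈block = tile-in-block block⊆ t∈ (All.lookup k<cells (first∈cells t)) first≤end
  ...   | no  first≰end = inj₂ (All.tabulate (λ c∈ → <-≤-trans (≰⇒> first≰end) (first≤cell c∈)))

  record Decomposition (k : ℕ) : Set where
    field
      blocks      : List Block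
      length      : k + sum (map len blocks) ≡ n
      complete    : ∀ t → t ∈ ts → k < first t → t ∈ placedTiles (placed (suc k) blocks)
      sound       : ∀ t → t ∈ placedTiles (placed (suc k) blocks) → t ∈ ts × k < first t
      unbreakable : All PlacedUnbreakable (placed (suc k) blocks)

  empty : Decomposition n
  empty = record
    { blocks      = []
    ; length      = +-identityʳ n
    ; complete    = λ t t∈ n<first → ⊥-elim (<⇒≱ n<first (proj₂ (inside t∈ (first∈cells t))))
    ; sound       = λ _ ()
    ; unbreakable = [] }

  extend : ∀ {b k} → blockTiles b (suc k) ⊆ ts → Decomposition (k + len b) → Decomposition k
  extend {b} {k} block⊆ rest = record
    { blocks      = b ∷ blocks
    ; length      = trans (sym (+-assoc k (len b) _)) length
    ; complete    = complete′
    ; sound       = sound′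
    ; unbreakable = block-unbreakable b k ∷ unbreakable }
    where
      open Decomposition rest
      complete′ : ∀ t → t ∈ ts → k < first t → t ∈ placedTiles (placed (suc k) (b ∷ blocks))
      complete′ t t∈ k<first with first t ≤? k + len b
      ... | yes first≤end = ∈-++⁺ˡ (tile-in-block block⊆ t∈ k<first first≤end)
      ... | no  first≰end = ∈-++⁺ʳ (blockTiles b (suc k)) (complete t t∈ (≰⇒> first≰end))
      sound′ : ∀ t → t ∈ placedTiles (placed (suc k) (b ∷ blocks)) → t ∈ ts × k < first t
      sound′ t t∈ with ∈-++⁻ (blockTiles b (suc k)) t∈
      ... | inj₁ t∈block = block⊆ t∈block , proj₁ (block-cell-bounds b k t∈block (first∈cells t))
      ... | inj₂ t∈rest with sound t t∈rest
      ...   | t∈ts , end<first = t∈ts , ≤-<-trans (m≤m+n k (len b)) end<first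

  decompose : ∀ k → Acc _<_ (n ∸ k) → k ≤ n → BreakableAt k ts → Decomposition k
  decompose k (acc smaller) k≤n breakable with m≤n⇒m<n∨m≡n k≤n
  ... | inj₂ refl = empty
  ... | inj₁ k<n with next-block k breakable k<n
  ...   | b , block⊆ =
    extend block⊆ (decompose (k + len b) (smaller (∸-monoʳ-< (m<m+n k (0<len b)) fits))
                    fits (breakable-after-block breakable block⊆))
    where
      fits : k + len b ≤ n
      fits = block-fits b k block⊆

  decomposition : Decomposition 0
  decomposition = decompose 0 (<-wellFounded n) z≤n breakable-at-0
    where
      breakable-at-0 : BreakableAt 0 ts
      breakable-at-0 t∈ = inj₂ (All.tabulate (proj₁ ∘ inside t∈))

-- The decomposition exists for every n.
lemma1 : ∀ (n : ℕ) → 4 < n → (ts : List Tile) → IsTiling n ts →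
    ∃[ bs ] (sum (map len bs) ≡ n
      × (∀ t → t ∈ ts → t ∈ placedTiles (placed 1 bs))
      × (∀ t → t ∈ placedTiles (placed 1 bs) → t ∈ ts)
      × All PlacedUnbreakable (placed 1 bs))
lemma1 n _ ts (inside , covered , disjoint) =
  blocks , length
  , (λ t t∈ → complete t t∈ (proj₁ (inside t∈ (first∈cells t))))
  , (λ t t∈ → proj₁ (sound t t∈))
  , unbreakable
  where open Greedy.Decomposition (Greedy.decomposition n ts inside covered disjoint)
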